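{- Let $t\in\mathbb{F}_{q^n}^*$ with $\mathrm{Tr}_{\mathbb{F}_{q^n}/\mathbb{F}_q}(t^2)=0$ and set $R_t=\langle(0,t)\rangle$. Let $x\in\mathbb{F}_{q^n}^*$ and let $y=x$ or $y=x\omega_0$, where $\langle(1,y)\rangle$ is a point of $H(n,q^2)$. Let $U=R_t^\perp\cap S_y$. Then $|U|=k(q+1)$ for some integer $k$, and if $k$ is odd then $\mathrm{Tr}_{\mathbb{F}_{q^n}/\mathbb{F}_q}(xt)=0$.
   Context: $q$ is a prime power and $n\ge 3$ odd. $V=\mathbb{F}_{q^2}\times\mathbb{F}_{q^{2n}}$ with Hermitian form $h((a,x),(b,y))=ab^q-\mathrm{Tr}_{\mathbb{F}_{q^{2n}}/\mathbb{F}_{q^2}}(xy^{q^n})$; $H(n,q^2)$ is the associated Hermitian polar space and $\perp$ its polarity (for a point $R$, $R^\perp$ is the set of projective points perpendicular to $R$). $\omega_0\in\mathbb{F}_{q^{2n}}$ has order $(q^n+1)(q-1)$ and $\omega=\omega_0^{q-1}$. For a point $\langle(1,y)\rangle$, $S_y=\{\langle(1,\omega^iy)\rangle:0\le i\le q^n\}$. -}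

module Defs where

open import Level using (Level; _⊔_)
open import Data.Nat using (ℕ; zero; suc; _<_; _^_)
open import Data.Product using (Σ; ∃; _×_; _,_)
open import Data.List using (List; length)
open import Data.List.Relation.Unary.Any using (Any)
open import Data.List.Relation.Unary.All using (All)
open import Data.List.Relation.Unary.AllPairs using (AllPairs)
open import Relation.Nullary using (¬_)
open import Relation.Binary.PropositionalEquality using (_≡_)
open import Algebra.Bundles using (CommutativeRing)

open import Data.Nat.Primality using (Prime)

PrimePower : ℕ → Set
PrimePower q = Σ ℕ λ p → Σ ℕ λ e → Prime p × (0 < e) × (q ≡ p ^ e)

module FF {c ℓ : Level} (R : CommutativeRing c ℓ) where
  open CommutativeRing R public using (Carrier; _≈_; _+_; _*_; -_; 0#; 1#)

  pow : Carrier → ℕ → Carrier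
  pow x zero    = 1#
  pow x (suc m) = x * pow x m

  _−_ : Carrier → Carrier → Carrier
  a − b = a + (- b)

  sumF : ℕ → (ℕ → Carrier) → Carrier
  sumF zero    f = 0#
  sumF (suc m) f = sumF m f + f m

  record IsFiniteFieldOfOrder (N : ℕ) : Set (c ⊔ ℓ) where
    field
      nontrivial : ¬ (1# ≈ 0#)
      inverses   : ∀ x → ¬ (x ≈ 0#) → Σ Carrier λ y → x * y ≈ 1#
      elems      : List Carrier
      complete   : ∀ x → Any (x ≈_) elems
      distinct   : AllPairs (λ a b → ¬ (a ≈ b)) elems
      card       : length elems ≡ N

  HasOrder : Carrier → ℕ → Set ℓ
  HasOrder g m = (pow g m ≈ 1#) × (∀ j → 0 < j → j < m → ¬ (pow g j ≈ 1#))

  -- With the carrier playing the role of F_{q^{2n}}: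
  module Setup (q n : ℕ) where
    -- subfield F_{q^e} = { z : z^{q^e} = z }
    InSub : ℕ → Carrier → Set ℓ
    InSub e z = pow z (q ^ e) ≈ z

    -- Tr_{F_{q^n}/F_q}(z) = Σ_{i<n} z^{q^i}
    TrQ : Carrier → Carrier
    TrQ z = sumF n (λ i → pow z (q ^ i))

    -- Tr_{F_{q^{2n}}/F_{q^2}}(z) = Σ_{i<n} z^{q^{2i}}
    TrQ2 : Carrier → Carrier
    TrQ2 z = sumF n (λ i → pow z (q ^ (2 Data.Nat.* i)))

    -- vectors of V = F_{q^2} × F_{q^{2n}}
    Vec : Set c
    Vec = Σ Carrier λ _ → Carrier

    InV : Vec → Set ℓ
    InV (a , _) = InSub 2 a

    NonZeroV : Vec → Set ℓ
    NonZeroV (a , z) = ¬ ((a ≈ 0#) × (z ≈ 0#))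

    h : Vec → Vec → Carrier
    h (a , x) (b , y) = (a * pow b q) − TrQ2 (x * pow y (q ^ n))

    SamePoint : Vec → Vec → Set (c ⊔ ℓ)
    SamePoint (a , x) (b , y) =
      Σ Carrier λ μ → InSub 2 μ × ¬ (μ ≈ 0#) × (b ≈ μ * a) × (y ≈ μ * x)

    IsPoint : Vec → Set ℓ
    IsPoint v = InV v × NonZeroV v

    InPerp : Vec → Vec → Set ℓ
    InPerp r v = h v r ≈ 0#

    -- ω = ω0^{q-1}; S_y = { <(1, ω^i y)> : 0 ≤ i ≤ q^n }
    InS : Carrier → Carrier → Vec → Set (c ⊔ ℓ)
    InS ω0 y v = Σ ℕ λ i → (i < suc (q ^ n)) ×
                   SamePoint v (1# , pow (pow ω0 (q Data.Nat.∸ 1)) i * y)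

    -- L is a list of representatives enumerating, without repetition,
    -- the set of projective points U = R_t^⊥ ∩ S_y
    EnumeratesU : Carrier → Carrier → Carrier → List Vec → Set (c ⊔ ℓ)
    EnumeratesU ω0 t y L =
      All (λ v → IsPoint v × InPerp (0# , t) v × InS ω0 y v) L ×
      AllPairs (λ v w → ¬ SamePoint v w) L ×
      (∀ v → IsPoint v → InPerp (0# , t) v → InS ω0 y v →
         Any (SamePoint v) L)

module Submission where

-- With Q = q^n and ω = ω0^(q−1) of order Q + 1 = (q + 1)·d (d odd, as n is
-- odd), S_y consists of the points ⟨(1, ω^i·y)⟩, i ≤ Q, and such a point lies
-- in R_t^⊥ iff T i = Tr_{F_{q^2n}/F_{q^2}}(ω^i·y·t) = 0.  As ω^d ∈ F_{q^2},
-- T (d + i) = ω^d·T i: the zeros of T are d-periodic, so |U| = (q + 1)·k with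
-- k the number of zeros in one period.  The Frobenius x ↦ x^Q sends y to
-- ω^c·y, which makes the zero set symmetric about R = c·(d + 1)/2 modulo d;
-- as d is odd, odd k forces T R = 0, and T R = β·Tr_{F_{q^2n}/F_{q^2}}(x·t)
-- with β ∈ F_{q^2}^*.  For odd n the two traces agree on F_{q^n}.

open import Level using (_⊔_)
open import Data.Nat as ℕ using (ℕ; zero; suc; _<_; z≤n; s≤s)
import Data.Nat.Properties as ℕP
open import Data.Nat.DivMod using (_/_)
open import Data.Nat.Divisibility using (_∣_; divides)
open import Data.Nat.Tactic.RingSolver using (solve-∀)
open import Data.Bool using (Bool; true; false)
open import Data.List using (List; []; _∷_; length; map)
open import Data.List.Relation.Unary.Any as Any using (Any; here; there)
open import Data.List.Relation.Unary.All using (All; []; _∷_)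
open import Data.List.Relation.Unary.AllPairs using (AllPairs; []; _∷_)
open import Data.Product using (Σ; _×_; _,_; proj₁; proj₂)
open import Data.Sum using (_⊎_; inj₁; inj₂)
open import Data.Empty using (⊥-elim)
open import Relation.Nullary using (¬_; Dec; yes; no; does)
open import Relation.Nullary.Decidable using (dec-true; does-⇔)
open import Relation.Binary.Bundles using (Setoid)
open import Relation.Binary.Definitions using (tri<; tri≈; tri>)
open import Function.Bundles using (mk⇔)
import Relation.Binary.PropositionalEquality as ≡
open ≡ using (_≡_)
open import Algebra.Bundles using (CommutativeMonoid; CommutativeRing)
open import Defs using (module FF; PrimePower)

module MemberSum {a ℓa c ℓ} (A : Setoid a ℓa) (M : CommutativeMonoid c ℓ)
    (f : Setoid.Carrier A → CommutativeMonoid.Carrier M)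
    (f-cong : ∀ {x y} → Setoid._≈_ A x y → CommutativeMonoid._≈_ M (f x) (f y)) where
  open Setoid A using () renaming
    (Carrier to X; _≈_ to _∼_; _≉_ to _≁_; refl to ∼-refl; sym to ∼-sym; trans to ∼-trans)
  open CommutativeMonoid M
  open import Algebra.Properties.CommutativeSemigroup commutativeSemigroup using (x∙yz≈y∙xz)

  _∈_ : X → List X → Set (a ⊔ ℓa)
  x ∈ L = Any (x ∼_) L

  Distinct : List X → Set (a ⊔ ℓa)
  Distinct = AllPairs _≁_

  sum : List X → Carrier
  sum []      = ε
  sum (x ∷ L) = f x ∙ sum L

  found : ∀ {x L} → x ∈ L → X
  found {L = y ∷ _} (here _) = y
  found (there p)             = found p

  found-∼ : ∀ {x L} (p : x ∈ L) → x ∼ found p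
  found-∼ (here e)  = e
  found-∼ (there p) = found-∼ p

  found-∈ : ∀ {x L} (p : x ∈ L) → found p ∈ L
  found-∈ (here _)  = here ∼-refl
  found-∈ (there p) = there (found-∈ p)

  remove : ∀ {x} L → x ∈ L → List X
  remove (_ ∷ L) (here _)  = L
  remove (y ∷ L) (there p) = y ∷ remove L p

  sum-remove : ∀ {x} L (p : x ∈ L) → sum L ≈ f (found p) ∙ sum (remove L p)
  sum-remove (_ ∷ L) (here _)  = refl
  sum-remove (y ∷ L) (there p) = trans (∙-congˡ (sum-remove L p)) (x∙yz≈y∙xz _ _ _)

  remove-⊆ : ∀ {x z} L (p : x ∈ L) → z ∈ remove L p → z ∈ L
  remove-⊆ (_ ∷ L) (here _)  q         = there q
  remove-⊆ (_ ∷ L) (there p) (here e)  = here e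
  remove-⊆ (_ ∷ L) (there p) (there q) = there (remove-⊆ L p q)

  remove-keeps : ∀ {x z} L (p : x ∈ L) → z ∈ L → ¬ (z ∼ found p) → z ∈ remove L p
  remove-keeps (_ ∷ L) (here _)  (here e)  ne = ⊥-elim (ne e)
  remove-keeps (_ ∷ L) (here _)  (there q) ne = q
  remove-keeps (_ ∷ L) (there p) (here e)  ne = here e
  remove-keeps (_ ∷ L) (there p) (there q) ne = there (remove-keeps L p q ne)

  all-≁ : ∀ {y z L} → All (y ≁_) L → z ∈ L → ¬ (z ∼ y)
  all-≁ (d ∷ _)  (here e)  z∼y = d (∼-trans (∼-sym z∼y) e)
  all-≁ (_ ∷ ds) (there q) z∼y = all-≁ ds q z∼y

  remove-distinct : ∀ {x} L (p : x ∈ L) → Distinct L → Distinct (remove L p)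
  remove-distinct (_ ∷ L) (here _)  (_ ∷ ds)  = ds
  remove-distinct (y ∷ L) (there p) (d ∷ ds) = remove-all L p d ∷ remove-distinct L p ds
    where
    remove-all : ∀ {x} L (p : x ∈ L) → All (y ≁_) L → All (y ≁_) (remove L p)
    remove-all (_ ∷ L) (here _)  (_ ∷ al) = al
    remove-all (_ ∷ L) (there p) (d ∷ al) = d ∷ remove-all L p al

  remove-drops : ∀ {x z} L (p : x ∈ L) → Distinct L → z ∈ remove L p → ¬ (z ∼ found p)
  remove-drops (_ ∷ L) (here _)  (d ∷ _)  q         = all-≁ d q
  remove-drops (_ ∷ L) (there p) (d ∷ _)  (here e)  z∼ =
    all-≁ d (found-∈ p) (∼-trans (∼-sym z∼) e)
  remove-drops (_ ∷ L) (there p) (_ ∷ ds) (there q) = remove-drops L p ds q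

  sum-members : ∀ L₁ L₂ → Distinct L₁ → Distinct L₂ →
    (∀ {z} → z ∈ L₁ → z ∈ L₂) → (∀ {z} → z ∈ L₂ → z ∈ L₁) → sum L₁ ≈ sum L₂
  sum-members [] [] _ _ _ _ = refl
  sum-members [] (y ∷ L₂) _ _ _ ⊇ with ⊇ (here ∼-refl)
  ... | ()
  sum-members (x ∷ L₁) L₂ (d ∷ ds₁) ds₂ ⊆ ⊇ = begin
    f x ∙ sum L₁              ≈⟨ ∙-congˡ (sum-members L₁ L₂′ ds₁ (remove-distinct L₂ p ds₂) ⊆′ ⊇′) ⟩
    f x ∙ sum L₂′             ≈⟨ ∙-congʳ (f-cong (found-∼ p)) ⟩
    f (found p) ∙ sum L₂′     ≈⟨ sum-remove L₂ p ⟨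
    sum L₂                    ∎
    where
    open import Relation.Binary.Reasoning.Setoid setoid
    p : x ∈ L₂
    p = ⊆ (here ∼-refl)
    L₂′ : List X
    L₂′ = remove L₂ p
    ⊆′ : ∀ {z} → z ∈ L₁ → z ∈ L₂′
    ⊆′ q = remove-keeps L₂ p (⊆ (there q)) (λ e → all-≁ d q (∼-trans e (∼-sym (found-∼ p))))
    ⊇′ : ∀ {z} → z ∈ L₂′ → z ∈ L₁
    ⊇′ q with ⊇ (remove-⊆ L₂ p q)
    ... | here e  = ⊥-elim (remove-drops L₂ p ds₂ q (∼-trans e (found-∼ p)))
    ... | there r = r

module Counting where
  open import Data.Nat using (_+_; _*_; _%_)
  open import Data.Nat.DivMod using (m*n%n≡0)
  open ≡ using (refl; sym; trans; cong; cong₂; module ≡-Reasoning)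
  open ℕP using (+-assoc; +-comm; +-suc; +-identityʳ)

  indicator : Bool → ℕ
  indicator true  = 1
  indicator false = 0

  count : (ℕ → Bool) → ℕ → ℕ
  count f zero    = 0
  count f (suc m) = count f m + indicator (f m)

  count-cong : ∀ {f g} m → (∀ i → f i ≡ g i) → count f m ≡ count g m
  count-cong zero    f≗g = refl
  count-cong (suc m) f≗g = cong₂ _+_ (count-cong m f≗g) (cong indicator (f≗g m))

  count-+ : ∀ f a b → count f (a + b) ≡ count f a + count (λ i → f (a + i)) b
  count-+ f a zero    = trans (cong (count f) (+-identityʳ a)) (sym (+-identityʳ _))
  count-+ f a (suc b) = begin
    count f (a + suc b)                                           ≡⟨ cong (count f) (+-suc a b) ⟩
    count f (a + b) + indicator (f (a + b))                       ≡⟨ cong (_+ indicator (f (a + b))) (count-+ f a b) ⟩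
    count f a + count (λ i → f (a + i)) b + indicator (f (a + b)) ≡⟨ +-assoc (count f a) _ _ ⟩
    count f a + count (λ i → f (a + i)) (suc b)                   ∎
    where open ≡-Reasoning

  Periodic : ℕ → (ℕ → Bool) → Set
  Periodic d f = ∀ i → f (d + i) ≡ f i

  count-periodic : ∀ f d → Periodic d f → ∀ k → count f (k * d) ≡ k * count f d
  count-periodic f d per zero    = refl
  count-periodic f d per (suc k) = trans (count-+ f d (k * d))
    (cong (count f d +_) (trans (count-cong (k * d) per) (count-periodic f d per k)))

  count-window-step : ∀ f d → Periodic (suc d) f → ∀ a →
    count (λ i → f (suc a + i)) (suc d) ≡ count (λ i → f (a + i)) (suc d)
  count-window-step f d per a = begin
    count F′ d + indicator (f (suc a + d))           ≡⟨ cong (λ u → count F′ d + indicator (f u)) (cong suc (+-comm a d)) ⟩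
    count F′ d + indicator (f (suc d + a))           ≡⟨ cong (λ u → count F′ d + indicator u) (per a) ⟩
    count F′ d + indicator (f a)                     ≡⟨ +-comm _ (indicator (f a)) ⟩
    indicator (f a) + count F′ d                     ≡⟨ cong₂ _+_ (cong (λ u → indicator (f u)) (sym (+-identityʳ a)))
                                                               (count-cong d (λ i → cong f (sym (+-suc a i)))) ⟩
    count F 1 + count (λ i → F (1 + i)) d           ≡⟨ count-+ F 1 d ⟨
    count F (suc d)                                  ∎
    where
    open ≡-Reasoning
    F F′ : ℕ → Bool
    F  i = f (a + i)
    F′ i = f (suc a + i)

  count-window : ∀ f d → Periodic (suc d) f → ∀ a → count (λ i → f (a + i)) (suc d) ≡ count f (suc d)
  count-window f d per zero    = refl
  count-window f d per (suc a) = trans (count-window-step f d per a) (count-window f d per a)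

  -- A test g invariant under i ↦ K − i hits an even number of times in any
  -- window [a, a + 2e) placed symmetrically (a + (a + 2e − 1) = K).
  count-symmetric-even : ∀ K g → (∀ i j → i + j ≡ K → g i ≡ g j) →
    ∀ e a → a + a + (e + e) ≡ suc K → Σ ℕ λ w → count (λ i → g (a + i)) (e + e) ≡ w + w
  count-symmetric-even K g sym-g zero    a _  = 0 , refl
  count-symmetric-even K g sym-g (suc e) a eq
    with count-symmetric-even K g sym-g e (suc a) (trans (shrink a e) eq)
    where
    shrink : ∀ a e → suc a + suc a + (e + e) ≡ a + a + (suc e + suc e)
    shrink = solve-∀
  ... | w , inner = indicator (g a) + w , (begin
    count G (suc e + suc e)                                          ≡⟨ cong (count G) (+-suc (suc e) e) ⟩
    count G (1 + (e + e)) + indicator (G (suc (e + e)))              ≡⟨ cong (_+ indicator (G (suc (e + e)))) (count-+ G 1 (e + e)) ⟩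
    indicator (g (a + 0)) + count (λ i → G (1 + i)) (e + e) + indicator (G (suc (e + e)))
      ≡⟨ cong₂ (λ u v → indicator (g u) + v + indicator (G (suc (e + e))))
               (+-identityʳ a) (count-cong (e + e) (λ i → cong g (+-suc a i))) ⟩
    indicator (g a) + count (λ i → g (suc a + i)) (e + e) + indicator (G (suc (e + e)))
      ≡⟨ cong₂ (λ u v → indicator (g a) + u + indicator v) inner (sym-g _ _ ends) ⟩
    indicator (g a) + (w + w) + indicator (g a)                      ≡⟨ regroup (indicator (g a)) w ⟩
    (indicator (g a) + w) + (indicator (g a) + w)                    ∎)
    where
    open ≡-Reasoning
    G : ℕ → Bool
    G i = g (a + i)
    regroup : ∀ b w → b + (w + w) + b ≡ (b + w) + (b + w)
    regroup = solve-∀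
    outer : ∀ a e → suc (a + suc (e + e) + a) ≡ a + a + (suc e + suc e)
    outer = solve-∀
    ends : a + suc (e + e) + a ≡ K
    ends = ℕP.suc-injective (trans (outer a e) eq)

  -- For g invariant under i ↦ d − i with d = 2e + 1, the hits in [1, d) pair
  -- off, so an odd number of hits in [0, d) forces a hit at the centre 0.
  count-odd⇒centre : ∀ g e → (∀ i j → i + j ≡ suc (e + e) → g i ≡ g j) →
    count g (suc (e + e)) % 2 ≡ 1 → g 0 ≡ true
  count-odd⇒centre g e sym-g odd with g 0 in g0
  ... | true  = refl
  ... | false with count-symmetric-even (suc (e + e)) g sym-g e 1 refl
  ...   | w , even = ⊥-elim (ℕP.0≢1+n (trans (sym is-even) odd))
    where
    double : ∀ w → 0 + (w + w) ≡ w * 2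
    double = solve-∀
    is-even : count g (suc (e + e)) % 2 ≡ 0
    is-even = begin
      count g (1 + (e + e)) % 2                                     ≡⟨ cong (_% 2) (count-+ g 1 (e + e)) ⟩
      (indicator (g 0) + count (λ i → g (1 + i)) (e + e)) % 2
        ≡⟨ cong (λ u → (indicator u + count (λ i → g (1 + i)) (e + e)) % 2) g0 ⟩
      (0 + count (λ i → g (1 + i)) (e + e)) % 2                    ≡⟨ cong (λ u → (0 + u) % 2) even ⟩
      (0 + (w + w)) % 2                                             ≡⟨ cong (_% 2) (double w) ⟩
      (w * 2) % 2                                                   ≡⟨ m*n%n≡0 w 2 ⟩
      0                                                             ∎
      where open ≡-Reasoning

  hits : (ℕ → Bool) → ℕ → List ℕ
  hits f zero    = []
  hits f (suc m) with f m
  ... | true  = m ∷ hits f m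
  ... | false = hits f m

  open MemberSum (≡.setoid ℕ) ℕP.+-0-commutativeMonoid (λ _ → 1) (λ _ → refl)
    using (_∈_; Distinct; sum; sum-members)

  hits-sound : ∀ f m {z} → z ∈ hits f m → z < m × f z ≡ true
  hits-sound f (suc m) p with f m in fm
  hits-sound f (suc m) (here refl) | true  = ℕP.n<1+n m , fm
  hits-sound f (suc m) (there p)   | true  = let (z<m , fz) = hits-sound f m p in ℕP.m<n⇒m<1+n z<m , fz
  hits-sound f (suc m) p           | false = let (z<m , fz) = hits-sound f m p in ℕP.m<n⇒m<1+n z<m , fz

  hits-complete : ∀ f m z → z < m → f z ≡ true → z ∈ hits f m
  hits-complete f (suc m) z z<m fz with f m in fm | ℕP.m<1+n⇒m<n∨m≡n z<m
  ... | true  | inj₂ refl = here refl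
  ... | true  | inj₁ z<m′ = there (hits-complete f m z z<m′ fz)
  ... | false | inj₂ refl with () ← trans (sym fz) fm
  ... | false | inj₁ z<m′ = hits-complete f m z z<m′ fz

  hits-distinct : ∀ f m → Distinct (hits f m)
  hits-distinct f zero    = []
  hits-distinct f (suc m) with f m
  ... | true  = fresh (hits f m) (λ p → proj₁ (hits-sound f m p)) ∷ hits-distinct f m
    where
    fresh : ∀ L → (∀ {z} → z ∈ L → z < m) → All (λ z → ¬ (m ≡ z)) L
    fresh []      _     = []
    fresh (z ∷ L) below = (λ { refl → ℕP.<-irrefl refl (below (here refl)) }) ∷ fresh L (λ p → below (there p))
  ... | false = hits-distinct f m

  hits-length : ∀ f m → length (hits f m) ≡ count f m
  hits-length f zero    = refl
  hits-length f (suc m) with f m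
  ... | true  = trans (+-comm 1 _) (cong (_+ 1) (hits-length f m))
  ... | false = trans (hits-length f m) (sym (+-identityʳ _))

  sum-length : ∀ L → sum L ≡ length L
  sum-length []      = refl
  sum-length (_ ∷ L) = cong suc (sum-length L)

  length-by-count : ∀ f m (L : List ℕ) → Distinct L →
    (∀ {z} → z ∈ L → z < m × f z ≡ true) → (∀ z → z < m → f z ≡ true → z ∈ L) →
    length L ≡ count f m
  length-by-count f m L distinct sound complete = begin
    length L           ≡⟨ sum-length L ⟨
    sum L              ≡⟨ sum-members L (hits f m) distinct (hits-distinct f m)
                            (λ p → let (z<m , fz) = sound p in hits-complete f m _ z<m fz)
                            (λ p → let (z<m , fz) = hits-sound f m p in complete _ z<m fz) ⟩
    sum (hits f m)     ≡⟨ sum-length (hits f m) ⟩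
    length (hits f m)  ≡⟨ hits-length f m ⟩
    count f m          ∎
    where open ≡-Reasoning

module Arithmetic where
  open import Data.Nat using (_+_; _*_; _∸_; _^_; _%_)
  open import Data.Nat.Divisibility using (∣⇒≤; ∣1⇒≡1; m∣m*n)
  open import Data.Nat.DivMod using (m≡m%n+[m/n]*n; m/n*n≡m)
  open import Data.Nat.Primality using (Prime; euclidsLemma; prime⇒nonTrivial)
  open import Data.Nat using (_!)
  open import Data.Nat.Combinatorics using (_C_; nCk≡n!/k![n-k]!; k![n∸k]!∣n!)
  open ℕP using (_!*_!≢0)
  open import Defs using (PrimePower)
  open ≡ using (refl; sym; trans; cong; cong₂; subst; module ≡-Reasoning)
  open ℕP using (<-irrefl; +-comm; +-cancelʳ-≡)

  positive : ∀ a b → 0 < a → 0 < b → 0 < a * b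
  positive (suc a) (suc b) _ _ = s≤s z≤n

  prime>1 : ∀ {p} → Prime p → 1 < p
  prime>1 {p} pp = ℕ.nonTrivial⇒n>1 p {{prime⇒nonTrivial pp}}

  primePower>1 : ∀ {q} → PrimePower q → 1 < q
  primePower>1 (p , e , pp , 0<e , refl) = ℕP.^-monoʳ-< p (prime>1 pp) 0<e

  -- a prime exceeds every factor of j! when j < p, so it cannot divide j!
  prime∤factorial : ∀ {p} → Prime p → ∀ j → j < p → ¬ (p ∣ j !)
  prime∤factorial pp zero    _   p∣1 = <-irrefl (sym (∣1⇒≡1 p∣1)) (prime>1 pp)
  prime∤factorial pp (suc j) j<p p∣ with euclidsLemma (suc j) (j !) pp p∣
  ... | inj₁ p∣j+1 = <-irrefl refl (ℕP.<-≤-trans j<p (∣⇒≤ p∣j+1))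
  ... | inj₂ p∣j!  = prime∤factorial pp j (ℕP.<-trans (ℕP.n<1+n j) j<p) p∣j!

  -- p divides (p choose k) for 0 < k < p: it divides p! = (p C k)·k!·(p−k)!
  -- but neither k! nor (p−k)!
  prime∣binomial : ∀ {p} → Prime p → ∀ k → 0 < k → k < p → p ∣ p C k
  prime∣binomial {p} pp k 0<k k<p with euclidsLemma (p C k) (k ! * (p ∸ k) !) pp p∣product
    where
    instance
      k![p-k]!≢0 : ℕ.NonZero (k ! * (p ∸ k) !)
      k![p-k]!≢0 = k !* (p ∸ k) !≢0
    product≡p! : (p C k) * (k ! * (p ∸ k) !) ≡ p !
    product≡p! = trans (cong (_* (k ! * (p ∸ k) !)) (nCk≡n!/k![n-k]! (ℕP.<⇒≤ k<p)))
                       (m/n*n≡m (k![n∸k]!∣n! (ℕP.<⇒≤ k<p)))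
    n∣n! : ∀ n → 0 < n → n ∣ n !
    n∣n! (suc n) _ = m∣m*n (n !)
    p∣p! : p ∣ p !
    p∣p! = n∣n! p (ℕP.<-trans ℕP.0<1+n (prime>1 pp))
    p∣product : p ∣ (p C k) * (k ! * (p ∸ k) !)
    p∣product = subst (p ∣_) (sym product≡p!) p∣p!
  ... | inj₁ p∣pCk = p∣pCk
  ... | inj₂ p∣k![p-k]! with euclidsLemma (k !) ((p ∸ k) !) pp p∣k![p-k]!
  ...   | inj₁ p∣k!     = ⊥-elim (prime∤factorial pp k k<p p∣k!)
  ...   | inj₂ p∣[p-k]! = ⊥-elim (prime∤factorial pp (p ∸ k) (ℕP.∸-monoʳ-< 0<k (ℕP.<⇒≤ k<p)) p∣[p-k]!)

  odd⇒2h+1 : ∀ n → n % 2 ≡ 1 → n ≡ suc (n / 2 + n / 2)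
  odd⇒2h+1 n odd = trans (m≡m%n+[m/n]*n n 2)
    (cong₂ _+_ odd (trans (ℕP.*-comm (n / 2) 2) (cong (n / 2 +_) (ℕP.+-identityʳ (n / 2)))))

  power≡1-mod : ∀ r n → Σ ℕ λ s → suc r ^ n ≡ suc (r * s)
  power≡1-mod r zero    = 0 , cong suc (sym (ℕP.*-zeroʳ r))
  power≡1-mod r (suc n) with power≡1-mod r n
  ... | s , eq = s + suc (r * s) , trans (cong (suc r *_) eq) (step r s)
    where
    step : ∀ r s → suc r * suc (r * s) ≡ suc (r * (s + suc (r * s)))
    step = solve-∀

  -- the triangular numbers r(r + 1)/2, needed to halve the even number r(r + 1)
  triangle : ℕ → ℕ
  triangle zero    = 0
  triangle (suc r) = triangle r + suc r

  triangle-double : ∀ r → triangle r + triangle r ≡ r * suc r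
  triangle-double zero    = refl
  triangle-double (suc r) = begin
    (triangle r + suc r) + (triangle r + suc r) ≡⟨ regroup (triangle r) r ⟩
    (triangle r + triangle r) + 2 * suc r       ≡⟨ cong (_+ 2 * suc r) (triangle-double r) ⟩
    r * suc r + 2 * suc r                       ≡⟨ close r ⟩
    suc r * suc (suc r)                         ∎
    where
    open ≡-Reasoning
    regroup : ∀ a r → (a + suc r) + (a + suc r) ≡ (a + a) + 2 * suc r
    regroup = solve-∀
    close : ∀ r → r * suc r + 2 * suc r ≡ suc r * suc (suc r)
    close = solve-∀

  -- For odd exponents, q + 1 divides q^n + 1 with an odd cofactor:
  -- q^(2h+3) + 1 = q²·(q^(2h+1) + 1) − (q − 1)(q + 1).
  power[2h+1]+1 : ∀ r h → Σ ℕ λ E → suc (suc r ^ suc (h + h)) ≡ suc (suc r) * suc (E + E)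
  power[2h+1]+1 r zero    = 0 , refl
  power[2h+1]+1 r (suc h) with power[2h+1]+1 r h
  ... | E , eq = E′ , +-cancelʳ-≡ (q * q) _ _ (begin
    suc (q ^ suc (suc h + suc h)) + q * q           ≡⟨ cong (λ u → suc (q ^ suc u) + q * q) (ℕP.+-suc (suc h) h) ⟩
    suc (q * (q * X)) + q * q                       ≡⟨ expand r X ⟩
    q * q * suc X + 1                               ≡⟨ cong (λ u → q * q * u + 1) eq ⟩
    q * q * (suc q * suc (E + E)) + 1               ≡⟨ collect r E ⟩
    suc q * suc (q * q * E + q * q * E) + suc q * (r * suc r) + q * q
                                                    ≡⟨ cong (λ u → suc q * suc (q * q * E + q * q * E) + suc q * u + q * q)
                                                            (sym (triangle-double r)) ⟩
    suc q * suc (q * q * E + q * q * E) + suc q * (T + T) + q * q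
                                                    ≡⟨ combine (suc q) (q * q * E) T (q * q) ⟩
    suc q * suc (E′ + E′) + q * q                   ∎)
    where
    open ≡-Reasoning
    q X T E′ : ℕ
    q = suc r
    X = suc r ^ suc (h + h)
    T = triangle r
    E′ = q * q * E + T
    expand : ∀ r X → suc (suc r * (suc r * X)) + suc r * suc r ≡ suc r * suc r * suc X + 1
    expand = solve-∀
    collect : ∀ r E → suc r * suc r * (suc (suc r) * suc (E + E)) + 1 ≡
      suc (suc r) * suc (suc r * suc r * E + suc r * suc r * E) + suc (suc r) * (r * suc r) + suc r * suc r
    collect = solve-∀
    combine : ∀ a b t c → a * suc (b + b) + a * (t + t) + c ≡ a * suc ((b + t) + (b + t)) + c
    combine = solve-∀

  odd-power+1 : ∀ r n → n % 2 ≡ 1 → Σ ℕ λ E → suc (suc r ^ n) ≡ suc (suc r) * suc (E + E)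
  odd-power+1 r n n-odd =
    subst (λ m → Σ ℕ λ E → suc (suc r ^ m) ≡ suc (suc r) * suc (E + E)) (sym (odd⇒2h+1 n n-odd)) (power[2h+1]+1 r (n / 2))

  q²≡1+r[q+1] : ∀ r → suc r ^ 2 ≡ suc (r * suc (suc r))
  q²≡1+r[q+1] r = expand r
    where
    expand : ∀ r → suc r * (suc r * 1) ≡ suc (r * suc (suc r))
    expand = solve-∀

  -- With Q + 1 = (q + 1)·d, d = 2E + 1 and Q = 1 + r·s: d divides
  -- 1 + r·s·(E + 1), because r·s = Q − 1 ≡ −2 (mod d).
  centre-divisible : ∀ r s E Q → r * s + 1 ≡ Q → suc Q ≡ suc (suc r) * suc (E + E) →
    Σ ℕ λ e′ → suc (r * (s * suc E)) ≡ suc (E + E) * e′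
  centre-divisible r s E Q rs+1≡Q Q+1≡ = suc (suc r) * E + suc r , +-cancelʳ-≡ (2 * suc E) _ _ (begin
    suc (r * (s * suc E)) + 2 * suc E              ≡⟨ spread r s E ⟩
    (r * s + 1 + 1) * suc E + 1                    ≡⟨ cong (λ u → (u + 1) * suc E + 1) rs+1≡Q ⟩
    (Q + 1) * suc E + 1                            ≡⟨ cong (λ u → u * suc E + 1) (trans (+-comm Q 1) Q+1≡) ⟩
    (suc (suc r) * suc (E + E)) * suc E + 1        ≡⟨ factor r E ⟩
    suc (E + E) * (suc (suc r) * E + suc r) + 2 * suc E ∎)
    where
    open ≡-Reasoning
    spread : ∀ r s E → suc (r * (s * suc E)) + 2 * suc E ≡ (r * s + 1 + 1) * suc E + 1
    spread = solve-∀
    factor : ∀ r E → (suc (suc r) * suc (E + E)) * suc E + 1 ≡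
      suc (E + E) * (suc (suc r) * E + suc r) + 2 * suc E
    factor = solve-∀

  -- The index identity behind the reflection symmetry of the zero set: with
  -- R = c·(E + 1), d = 2E + 1 and Q ≡ −1 (mod d), the map i ↦ i·Q + c sends
  -- R + j to R + j′ modulo d whenever j + j′ = d.
  reflection-index : ∀ c E j j′ Q q → j + j′ ≡ suc (E + E) → Q + 1 ≡ suc q * suc (E + E) →
    (c * suc E + j) * Q + c + suc (E + E) * (c + 1) ≡
    (c * suc E + j′) + suc (E + E) * ((c * suc E + j) * suc q)
  reflection-index c E j j′ Q q j+j′≡d Q+1≡ = +-cancelʳ-≡ (R + j) _ _ (begin
    (R + j) * Q + c + d * (c + 1) + (R + j)                       ≡⟨ absorb c E j Q ⟩
    (R + j) * (Q + 1) + c + d * (c + 1)                           ≡⟨ cong (λ u → (R + j) * u + c + d * (c + 1)) Q+1≡ ⟩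
    (R + j) * (suc q * d) + c + d * (c + 1)                       ≡⟨ rearrange c E j q ⟩
    R + R + d + d * ((R + j) * suc q)                             ≡⟨ cong (λ u → R + R + u + d * ((R + j) * suc q)) (sym j+j′≡d) ⟩
    R + R + (j + j′) + d * ((R + j) * suc q)                      ≡⟨ swap R j j′ (d * ((R + j) * suc q)) ⟩
    (R + j′) + d * ((R + j) * suc q) + (R + j)                    ∎)
    where
    open ≡-Reasoning
    R d : ℕ
    R = c * suc E
    d = suc (E + E)
    absorb : ∀ c E j Q → (c * suc E + j) * Q + c + suc (E + E) * (c + 1) + (c * suc E + j) ≡
      (c * suc E + j) * (Q + 1) + c + suc (E + E) * (c + 1)
    absorb = solve-∀
    rearrange : ∀ c E j q → (c * suc E + j) * (suc q * suc (E + E)) + c + suc (E + E) * (c + 1) ≡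
      c * suc E + c * suc E + suc (E + E) + suc (E + E) * ((c * suc E + j) * suc q)
    rearrange = solve-∀
    swap : ∀ a j j′ z → a + a + (j + j′) + z ≡ (a + j′) + z + (a + j)
    swap = solve-∀

module FieldTheory {c ℓ} (F : CommutativeRing c ℓ) where
  open CommutativeRing F
  open FF F using (pow; sumF; _−_; IsFiniteFieldOfOrder)
  open import Relation.Binary.Reasoning.Setoid setoid
  open import Algebra.Properties.Semiring.Exp semiring using (_^_; ^-homo-*; ^-assocʳ)
  open import Algebra.Properties.CommutativeSemiring.Exp commutativeSemiring using (^-distrib-*)
  open import Algebra.Properties.CommutativeSemigroup +-commutativeSemigroup
    using () renaming (interchange to +-interchange)
  open import Algebra.Properties.Ring ring using (-‿distribʳ-*)

  pow≈^ : ∀ x k → pow x k ≈ x ^ k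
  pow≈^ x zero    = refl
  pow≈^ x (suc k) = *-congˡ (pow≈^ x k)

  pow-cong : ∀ {a b} k → a ≈ b → pow a k ≈ pow b k
  pow-cong zero    _ = refl
  pow-cong (suc k) e = *-cong e (pow-cong k e)

  pow-+ : ∀ x a b → pow x (a ℕ.+ b) ≈ pow x a * pow x b
  pow-+ x a b = trans (pow≈^ x (a ℕ.+ b)) (trans (^-homo-* x a b) (sym (*-cong (pow≈^ x a) (pow≈^ x b))))

  pow-* : ∀ x a b → pow x (a ℕ.* b) ≈ pow (pow x a) b
  pow-* x a b = begin
    pow x (a ℕ.* b)    ≈⟨ pow≈^ x (a ℕ.* b) ⟩
    x ^ (a ℕ.* b)      ≈⟨ ^-assocʳ x a b ⟨
    (x ^ a) ^ b        ≈⟨ pow≈^ (x ^ a) b ⟨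
    pow (x ^ a) b      ≈⟨ pow-cong b (pow≈^ x a) ⟨
    pow (pow x a) b    ∎

  pow-distrib : ∀ x y k → pow (x * y) k ≈ pow x k * pow y k
  pow-distrib x y k = trans (pow≈^ _ k) (trans (^-distrib-* x y k) (sym (*-cong (pow≈^ x k) (pow≈^ y k))))

  pow-comm : ∀ x a b → pow (pow x a) b ≈ pow (pow x b) a
  pow-comm x a b = trans (sym (pow-* x a b)) (trans (reflexive (≡.cong (pow x) (ℕP.*-comm a b))) (pow-* x b a))

  pow-1 : ∀ k → pow 1# k ≈ 1#
  pow-1 zero    = refl
  pow-1 (suc k) = trans (*-identityˡ _) (pow-1 k)

  pow-0 : ∀ k → 0 < k → pow 0# k ≈ 0#
  pow-0 (suc k) _ = zeroˡ _

  pow-fixed : ∀ {a} K → pow a K ≈ a → ∀ k → pow a (K ℕ.^ k) ≈ a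
  pow-fixed K e zero    = *-identityʳ _
  pow-fixed {a} K e (suc k) = begin
    pow a (K ℕ.* K ℕ.^ k)     ≈⟨ pow-* a K (K ℕ.^ k) ⟩
    pow (pow a K) (K ℕ.^ k)   ≈⟨ pow-cong (K ℕ.^ k) e ⟩
    pow a (K ℕ.^ k)           ≈⟨ pow-fixed K e k ⟩
    a                         ∎

  sumF-cong : ∀ m {f g} → (∀ i → f i ≈ g i) → sumF m f ≈ sumF m g
  sumF-cong zero    _   = refl
  sumF-cong (suc m) f≈g = +-cong (sumF-cong m f≈g) (f≈g m)

  sumF-*ˡ : ∀ m a f → a * sumF m f ≈ sumF m (λ i → a * f i)
  sumF-*ˡ zero    a f = zeroʳ a
  sumF-*ˡ (suc m) a f = trans (distribˡ _ _ _) (+-congʳ (sumF-*ˡ m a f))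

  sumF-split : ∀ m k f → sumF (m ℕ.+ k) f ≈ sumF m f + sumF k (λ i → f (m ℕ.+ i))
  sumF-split m zero f =
    trans (reflexive (≡.cong (λ u → sumF u f) (ℕP.+-identityʳ m))) (sym (+-identityʳ _))
  sumF-split m (suc k) f = begin
    sumF (m ℕ.+ suc k) f                                   ≡⟨ ≡.cong (λ u → sumF u f) (ℕP.+-suc m k) ⟩
    sumF (m ℕ.+ k) f + f (m ℕ.+ k)                         ≈⟨ +-congʳ (sumF-split m k f) ⟩
    (sumF m f + sumF k (λ i → f (m ℕ.+ i))) + f (m ℕ.+ k)  ≈⟨ +-assoc _ _ _ ⟩
    sumF m f + sumF (suc k) (λ i → f (m ℕ.+ i))            ∎

  sumF-even-odd : ∀ h f → sumF (suc (h ℕ.+ h)) f ≈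
    sumF (suc h) (λ i → f (i ℕ.+ i)) + sumF h (λ i → f (suc (i ℕ.+ i)))
  sumF-even-odd zero    f = sym (+-identityʳ _)
  sumF-even-odd (suc h) f = begin
    sumF (suc (suc h ℕ.+ suc h)) f                 ≡⟨ ≡.cong (λ m → sumF (suc m) f) (ℕP.+-suc (suc h) h) ⟩
    sumF (suc (h ℕ.+ h)) f + f₁ + f₂              ≈⟨ +-congʳ (+-congʳ (sumF-even-odd h f)) ⟩
    (Even + Odd) + f₁ + f₂                         ≈⟨ +-assoc _ _ _ ⟩
    (Even + Odd) + (f₁ + f₂)                       ≈⟨ +-congˡ (+-comm _ _) ⟩
    (Even + Odd) + (f₂ + f₁)                       ≈⟨ +-interchange _ _ _ _ ⟩
    (Even + f₂) + (Odd + f₁)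
      ≡⟨ ≡.cong (λ u → (Even + f u) + (Odd + f₁)) (≡.cong suc (≡.sym (ℕP.+-suc h h))) ⟩
    (Even + f (suc h ℕ.+ suc h)) + (Odd + f₁)      ∎
    where
    Even Odd f₁ f₂ : Carrier
    Even = sumF (suc h) (λ i → f (i ℕ.+ i))
    Odd  = sumF h (λ i → f (suc (i ℕ.+ i)))
    f₁   = f (suc (h ℕ.+ h))
    f₂   = f (suc (suc (h ℕ.+ h)))

  module FiniteField (N : ℕ) (fin : IsFiniteFieldOfOrder N) where
    open IsFiniteFieldOfOrder fin
    open import Data.Nat.Primality using (Prime)
    open import Algebra.Definitions.RawMonoid +-rawMonoid using () renaming (_×_ to _⊗_)
    open import Algebra.Properties.Semiring.Mult semiring using (×1-homo-*; ×-assoc-*)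
    open import Data.List.Relation.Unary.All using (lookupAny)
    open import Data.List.Relation.Unary.Any.Properties using (lookup-result)
    import Data.Fin as Fin
    import Data.Fin.Properties as FinP

    -- Equality is decidable: compare the positions of x and y in the
    -- enumeration `elems`, whose entries are pairwise distinct.
    distinct-positions : ∀ {x y} {L : List Carrier} → AllPairs (λ a b → ¬ (a ≈ b)) L →
      (p : Any (x ≈_) L) (q : Any (y ≈_) L) → ¬ (Any.index p ≡ Any.index q) → ¬ (Any.lookup p ≈ Any.lookup q)
    distinct-positions _        (here _)  (here _)  ne = ⊥-elim (ne ≡.refl)
    distinct-positions (d ∷ _)  (here _)  (there q) _  = proj₁ (lookupAny d q)
    distinct-positions (d ∷ _)  (there p) (here _)  _  e = proj₁ (lookupAny d p) (sym e)
    distinct-positions (_ ∷ ds) (there p) (there q) ne = distinct-positions ds p q (λ e → ne (≡.cong Fin.suc e))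

    _≟_ : ∀ x y → Dec (x ≈ y)
    x ≟ y with complete x | complete y
    ... | p | q with Any.index p Fin.≟ Any.index q
    ...   | yes same  = yes (trans (lookup-result p)
                               (trans (reflexive (≡.cong (Data.List.lookup elems) same)) (sym (lookup-result q))))
    ...   | no  differ = no (λ x≈y → distinct-positions distinct p q differ
                               (trans (sym (lookup-result p)) (trans x≈y (lookup-result q))))

    no-zero-divisors : ∀ {a b} → a * b ≈ 0# → ¬ (a ≈ 0#) → b ≈ 0#
    no-zero-divisors {a} {b} ab≈0 a≉0 with inverses a a≉0
    ... | a⁻¹ , aa⁻¹≈1 = begin
      b                 ≈⟨ *-identityˡ b ⟨
      1# * b            ≈⟨ *-congʳ (trans (sym aa⁻¹≈1) (*-comm a a⁻¹)) ⟩
      (a⁻¹ * a) * b     ≈⟨ *-assoc _ _ _ ⟩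
      a⁻¹ * (a * b)     ≈⟨ *-congˡ ab≈0 ⟩
      a⁻¹ * 0#          ≈⟨ zeroʳ a⁻¹ ⟩
      0#                ∎

    *-nonzero : ∀ {a b} → ¬ (a ≈ 0#) → ¬ (b ≈ 0#) → ¬ (a * b ≈ 0#)
    *-nonzero a≉0 b≉0 ab≈0 = b≉0 (no-zero-divisors ab≈0 a≉0)

    pow-nonzero : ∀ {a} k → ¬ (a ≈ 0#) → ¬ (pow a k ≈ 0#)
    pow-nonzero zero    _   = nontrivial
    pow-nonzero (suc k) a≉0 = *-nonzero a≉0 (pow-nonzero k a≉0)

    pow≈0⇒≈0 : ∀ {a} k → pow a k ≈ 0# → a ≈ 0#
    pow≈0⇒≈0 {a} k aᵏ≈0 with a ≟ 0#
    ... | yes a≈0 = a≈0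
    ... | no  a≉0 = ⊥-elim (pow-nonzero k a≉0 aᵏ≈0)

    *-cancelˡ : ∀ {a b d} → ¬ (a ≈ 0#) → a * b ≈ a * d → b ≈ d
    *-cancelˡ {a} {b} {d} a≉0 ab≈ad = begin
      b                 ≈⟨ +-identityʳ b ⟨
      b + 0#            ≈⟨ +-congˡ (-‿inverseˡ d) ⟨
      b + (- d + d)     ≈⟨ +-assoc _ _ _ ⟨
      (b − d) + d       ≈⟨ +-congʳ b−d≈0 ⟩
      0# + d            ≈⟨ +-identityˡ d ⟩
      d                 ∎
      where
      b−d≈0 : b − d ≈ 0#
      b−d≈0 = no-zero-divisors
        (trans (distribˡ a b (- d)) (trans (+-cong ab≈ad (sym (-‿distribʳ-* a d))) (-‿inverseʳ _))) a≉0

    ι : ℕ → Carrier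
    ι n = n ⊗ 1#

    -- N·1 = 0: translating by 1 permutes F, so the sum of all 1 + x equals the sum of all x.
    order-annihilates : ι N ≈ 0#
    order-annihilates = +-cancelʳ (begin
      ι N + total elems                 ≡⟨ ≡.cong (λ m → ι m + total elems) (≡.sym card) ⟩
      ι (length elems) + total elems    ≈⟨ total-shift elems ⟨
      total (map (1# +_) elems)         ≈⟨ sum-members _ _ shifted-distinct distinct
                                         (λ {z} _ → complete z) (λ {z} _ → shifted-complete z) ⟩
      total elems                       ≈⟨ +-identityˡ _ ⟨
      0# + total elems                  ∎)
      where
      open MemberSum setoid +-commutativeMonoid (λ x → x) (λ e → e) using (sum-members) renaming (sum to total)
      import Data.List.Relation.Unary.Any.Properties as AnyP
      import Data.List.Relation.Unary.AllPairs.Properties as AllPairsP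
      import Data.List.Relation.Unary.AllPairs as AllPairs
      open import Algebra.Properties.Group +-group using (∙-cancelʳ; ∙-cancelˡ)
      +-cancelʳ : ∀ {a b} → a + total elems ≈ b + total elems → a ≈ b
      +-cancelʳ = ∙-cancelʳ _ _ _
      total-shift : ∀ L → total (map (1# +_) L) ≈ ι (length L) + total L
      total-shift []      = sym (+-identityʳ _)
      total-shift (x ∷ L) = trans (+-congˡ (total-shift L)) (+-interchange _ _ _ _)
      shifted-complete : ∀ z → Any (z ≈_) (map (1# +_) elems)
      shifted-complete z = AnyP.map⁺ (Any.map (λ {w} z−1≈w → trans (sym z≈1+[z−1]) (+-congˡ z−1≈w)) (complete (z − 1#)))
        where
        z≈1+[z−1] : 1# + (z − 1#) ≈ z
        z≈1+[z−1] = trans (+-comm _ _) (trans (+-assoc _ _ _) (trans (+-congˡ (-‿inverseˡ 1#)) (+-identityʳ z)))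
      shifted-distinct : AllPairs (λ a b → ¬ (a ≈ b)) (map (1# +_) elems)
      shifted-distinct = AllPairsP.map⁺ (AllPairs.map (λ a≉b e → a≉b (∙-cancelˡ _ _ _ e)) distinct)

    ι-pow : ∀ a k → ι (a ℕ.^ k) ≈ pow (ι a) k
    ι-pow a zero    = +-identityʳ 1#
    ι-pow a (suc k) = trans (×1-homo-* a (a ℕ.^ k)) (*-congˡ (ι-pow a k))

    -- If N = p^k then p·1 = 0 in F (k = 0 is impossible: F is nontrivial).
    characteristic : ∀ p k → N ≡ p ℕ.^ k → ι p ≈ 0#
    characteristic p zero N≡1 =
      ⊥-elim (nontrivial (trans (sym (+-identityʳ 1#)) (≡.subst (λ m → ι m ≈ 0#) N≡1 order-annihilates)))
    characteristic p (suc k) N≡pᵏ =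
      pow≈0⇒≈0 (suc k) (trans (sym (ι-pow p (suc k))) (≡.subst (λ m → ι m ≈ 0#) N≡pᵏ order-annihilates))

    -- The freshman's dream (a + b)^p = a^p + b^p when p is a prime with
    -- p·1 = 0: the inner binomial coefficients are multiples of p.
    module Freshman where
      open import Algebra.Properties.CommutativeSemiring.Binomial commutativeSemiring as Binomial
        using (binomialTerm; binomial)
      open import Algebra.Properties.Monoid.Sum +-monoid using (sum; sum-init-last; sum-cong-≋; sum-replicate-zero)
      open import Algebra.Properties.Monoid.Mult +-monoid using (×-congʳ)
      open import Data.Nat.Combinatorics using (_C_; nCn≡1)
      open Fin using (Fin; toℕ; inject₁; fromℕ)

      ⊗≈ι* : ∀ n x → n ⊗ x ≈ ι n * x
      ⊗≈ι* n x = sym (trans (×-assoc-* n 1# x) (×-congʳ n (*-identityˡ x)))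

      module _ {m} (isPrime : Prime (suc m)) (char : ι (suc m) ≈ 0#) (a b : Carrier) where
        term : Fin (suc (suc m)) → Carrier
        term = binomialTerm a b (suc m)

        first-term : term Fin.zero ≈ pow b (suc m)
        first-term = begin
          (suc m C 0) ⊗ (a ^ 0 * b ^ suc m) ≈⟨ ⊗≈ι* (suc m C 0) _ ⟩
          ι 1 * (1# * b ^ suc m)             ≈⟨ *-cong (+-identityʳ 1#) (*-identityˡ _) ⟩
          1# * b ^ suc m                     ≈⟨ *-identityˡ _ ⟩
          b ^ suc m                          ≈⟨ pow≈^ b (suc m) ⟨
          pow b (suc m)                      ∎

        last-term : term (Fin.suc (fromℕ m)) ≈ pow a (suc m)
        last-term = begin
          (suc m C suc (toℕ (fromℕ m))) ⊗ (a ^ suc (toℕ (fromℕ m)) * b ^ (m ℕ.∸ toℕ (fromℕ m)))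
            ≡⟨ ≡.cong (λ k → (suc m C suc k) ⊗ (a ^ suc k * b ^ (m ℕ.∸ k))) (FinP.toℕ-fromℕ m) ⟩
          (suc m C suc m) ⊗ (a ^ suc m * b ^ (m ℕ.∸ m))
            ≡⟨ ≡.cong₂ (λ u v → u ⊗ (a ^ suc m * b ^ v)) (nCn≡1 (suc m)) (ℕP.n∸n≡0 m) ⟩
          (a ^ suc m * 1#) + 0#              ≈⟨ trans (+-identityʳ _) (*-identityʳ _) ⟩
          a ^ suc m                          ≈⟨ pow≈^ a (suc m) ⟨
          pow a (suc m)                      ∎

        inner-term : ∀ (i : Fin m) → term (Fin.suc (inject₁ i)) ≈ 0#
        inner-term i with Arithmetic.prime∣binomial isPrime (suc k) (s≤s z≤n) (s≤s k<m)
          where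
          k : ℕ
          k = toℕ (inject₁ i)
          k<m : k < m
          k<m = ≡.subst (_< m) (≡.sym (FinP.toℕ-inject₁ i)) (FinP.toℕ<n i)
        ... | divides j C≡j[m+1] = begin
          (suc m C suc (toℕ (inject₁ i))) ⊗ B  ≈⟨ ⊗≈ι* (suc m C suc (toℕ (inject₁ i))) B ⟩
          ι (suc m C suc (toℕ (inject₁ i))) * B ≡⟨ ≡.cong (λ u → ι u * B) C≡j[m+1] ⟩
          ι (j ℕ.* suc m) * B                   ≈⟨ *-congʳ (×1-homo-* j (suc m)) ⟩
          (ι j * ι (suc m)) * B                 ≈⟨ *-congʳ (trans (*-congˡ char) (zeroʳ _)) ⟩
          0# * B                                ≈⟨ zeroˡ B ⟩
          0#                                    ∎
          where
          B : Carrier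
          B = binomial a b (suc m) (Fin.suc (inject₁ i))

        freshman : pow (a + b) (suc m) ≈ pow a (suc m) + pow b (suc m)
        freshman = begin
          pow (a + b) (suc m)                   ≈⟨ pow≈^ (a + b) (suc m) ⟩
          (a + b) ^ suc m                       ≈⟨ Binomial.theorem (suc m) a b ⟩
          term Fin.zero + sum (λ i → term (Fin.suc i))
                                                ≈⟨ +-congˡ (sum-init-last (λ i → term (Fin.suc i))) ⟩
          term Fin.zero + (sum (λ i → term (Fin.suc (inject₁ i))) + term (Fin.suc (fromℕ m)))
                                                ≈⟨ +-cong first-term (+-cong inner last-term) ⟩
          pow b (suc m) + (0# + pow a (suc m))  ≈⟨ +-congˡ (+-identityˡ _) ⟩
          pow b (suc m) + pow a (suc m)         ≈⟨ +-comm _ _ ⟩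
          pow a (suc m) + pow b (suc m)         ∎
          where
          inner : sum (λ i → term (Fin.suc (inject₁ i))) ≈ 0#
          inner = trans (sum-cong-≋ inner-term) (sum-replicate-zero m)

    frobenius-prime : ∀ p → Prime p → ι p ≈ 0# → ∀ k a b →
      pow (a + b) (p ℕ.^ k) ≈ pow a (p ℕ.^ k) + pow b (p ℕ.^ k)
    frobenius-prime zero    isPrime _    _       _ _ with () ← Arithmetic.prime>1 isPrime
    frobenius-prime (suc m) isPrime char zero    a b =
      trans (*-identityʳ _) (sym (+-cong (*-identityʳ a) (*-identityʳ b)))
    frobenius-prime (suc m) isPrime char (suc k) a b = begin
      pow (a + b) (p ℕ.* p ℕ.^ k)                              ≈⟨ pow-* (a + b) p (p ℕ.^ k) ⟩
      pow (pow (a + b) p) (p ℕ.^ k)                            ≈⟨ pow-cong (p ℕ.^ k) (Freshman.freshman isPrime char a b) ⟩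
      pow (pow a p + pow b p) (p ℕ.^ k)                        ≈⟨ frobenius-prime p isPrime char k _ _ ⟩
      pow (pow a p) (p ℕ.^ k) + pow (pow b p) (p ℕ.^ k)        ≈⟨ +-cong (pow-* a p (p ℕ.^ k)) (pow-* b p (p ℕ.^ k)) ⟨
      pow a (p ℕ.* p ℕ.^ k) + pow b (p ℕ.* p ℕ.^ k)            ∎
      where
      p : ℕ
      p = suc m

    frobenius : ∀ {q} m → PrimePower q → N ≡ q ℕ.^ m → ∀ j a b →
      pow (a + b) (q ℕ.^ j) ≈ pow a (q ℕ.^ j) + pow b (q ℕ.^ j)
    frobenius m (p , e , isPrime , _ , ≡.refl) N≡qᵐ j a b =
      ≡.subst (λ k → pow (a + b) k ≈ pow a k + pow b k) (≡.sym (ℕP.^-*-assoc p e j))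
        (frobenius-prime p isPrime (characteristic p (e ℕ.* m) (≡.trans N≡qᵐ (ℕP.^-*-assoc p e m))) (e ℕ.* j) a b)

  pow-sumF : ∀ K → 0 < K → (∀ a b → pow (a + b) K ≈ pow a K + pow b K) →
    ∀ m g → pow (sumF m g) K ≈ sumF m (λ i → pow (g i) K)
  pow-sumF K 0<K additive zero    g = pow-0 K 0<K
  pow-sumF K 0<K additive (suc m) g = trans (additive _ _) (+-congʳ (pow-sumF K 0<K additive m g))

  module Traces (q n : ℕ) where
    open FF.Setup F q n using (TrQ; TrQ2; InSub)

    TrQ2-cong : ∀ {a b} → a ≈ b → TrQ2 a ≈ TrQ2 b
    TrQ2-cong a≈b = sumF-cong n (λ i → pow-cong (q ℕ.^ (2 ℕ.* i)) a≈b)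

    TrQ2-scale : ∀ λ′ z → InSub 2 λ′ → TrQ2 (λ′ * z) ≈ λ′ * TrQ2 z
    TrQ2-scale λ′ z λ′∈Fq² = begin
      TrQ2 (λ′ * z)
        ≈⟨ sumF-cong n (λ i → trans (pow-distrib λ′ z (q ℕ.^ (2 ℕ.* i))) (*-congʳ (fixed i))) ⟩
      sumF n (λ i → λ′ * pow z (q ℕ.^ (2 ℕ.* i))) ≈⟨ sumF-*ˡ n λ′ _ ⟨
      λ′ * TrQ2 z                                 ∎
      where
      fixed : ∀ i → pow λ′ (q ℕ.^ (2 ℕ.* i)) ≈ λ′
      fixed i = ≡.subst (λ u → pow λ′ u ≈ λ′) (ℕP.^-*-assoc q 2 i) (pow-fixed (q ℕ.^ 2) λ′∈Fq² i)

    TrQ2-kernel-frobenius : 0 < q → (∀ a b → pow (a + b) (q ℕ.^ n) ≈ pow a (q ℕ.^ n) + pow b (q ℕ.^ n)) →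
      ∀ z → TrQ2 z ≈ 0# → TrQ2 (pow z (q ℕ.^ n)) ≈ 0#
    TrQ2-kernel-frobenius 0<q additive z TrQ2z≈0 = begin
      TrQ2 (pow z Q)                                 ≈⟨ sumF-cong n (λ i → pow-comm z Q (q ℕ.^ (2 ℕ.* i))) ⟩
      sumF n (λ i → pow (pow z (q ℕ.^ (2 ℕ.* i))) Q) ≈⟨ pow-sumF Q 0<Q additive n _ ⟨
      pow (TrQ2 z) Q                                 ≈⟨ pow-cong Q TrQ2z≈0 ⟩
      pow 0# Q                                       ≈⟨ pow-0 Q 0<Q ⟩
      0#                                             ∎
      where
      Q : ℕ
      Q = q ℕ.^ n
      0<Q : 0 < Q
      0<Q = ℕP.m^n>0 q {{ℕ.>-nonZero 0<q}} n

    -- For n = 2h + 1 and z ∈ F_{q^n}, the exponents q^(2i) with i < n run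
    -- through q^j (j < n) modulo z^(q^n) = z: even j for i ≤ h, odd j for i > h.
    TrQ2≈TrQ : ∀ h → n ≡ suc (h ℕ.+ h) → ∀ z → pow z (q ℕ.^ n) ≈ z → TrQ2 z ≈ TrQ z
    TrQ2≈TrQ h ≡.refl z z∈Fqⁿ = begin
      sumF (suc h ℕ.+ h) (λ i → pow z (q ℕ.^ (2 ℕ.* i)))
        ≈⟨ sumF-split (suc h) h _ ⟩
      sumF (suc h) (λ i → pow z (q ℕ.^ (2 ℕ.* i))) + sumF h (λ i → pow z (q ℕ.^ (2 ℕ.* (suc h ℕ.+ i))))
        ≈⟨ +-cong (sumF-cong (suc h) (λ i → reflexive (≡.cong (λ u → pow z (q ℕ.^ u)) (double i)))) (sumF-cong h wrap) ⟩
      sumF (suc h) (λ i → pow z (q ℕ.^ (i ℕ.+ i))) + sumF h (λ i → pow z (q ℕ.^ suc (i ℕ.+ i)))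
        ≈⟨ sumF-even-odd h _ ⟨
      sumF (suc (h ℕ.+ h)) (λ i → pow z (q ℕ.^ i)) ∎
      where
      n′ : ℕ
      n′ = suc (h ℕ.+ h)
      double : ∀ i → 2 ℕ.* i ≡ i ℕ.+ i
      double = solve-∀
      beyond : ∀ h i → 2 ℕ.* (suc h ℕ.+ i) ≡ suc (h ℕ.+ h) ℕ.+ suc (i ℕ.+ i)
      beyond = solve-∀
      wrap : ∀ i → pow z (q ℕ.^ (2 ℕ.* (suc h ℕ.+ i))) ≈ pow z (q ℕ.^ suc (i ℕ.+ i))
      wrap i = begin
        pow z (q ℕ.^ (2 ℕ.* (suc h ℕ.+ i)))                ≡⟨ ≡.cong (λ u → pow z (q ℕ.^ u)) (beyond h i) ⟩
        pow z (q ℕ.^ (n′ ℕ.+ suc (i ℕ.+ i)))               ≡⟨ ≡.cong (pow z) (ℕP.^-distribˡ-+-* q n′ _) ⟩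
        pow z (q ℕ.^ n′ ℕ.* q ℕ.^ suc (i ℕ.+ i))           ≈⟨ pow-* z (q ℕ.^ n′) _ ⟩
        pow (pow z (q ℕ.^ n′)) (q ℕ.^ suc (i ℕ.+ i))       ≈⟨ pow-cong (q ℕ.^ suc (i ℕ.+ i)) z∈Fqⁿ ⟩
        pow z (q ℕ.^ suc (i ℕ.+ i))                        ∎

  as-power-multiple : ∀ {x y ω0} → (y ≈ x) ⊎ (y ≈ x * ω0) → Σ ℕ λ e → y ≈ x * pow ω0 e
  as-power-multiple (inj₁ y≈x)   = 0 , trans y≈x (sym (*-identityʳ _))
  as-power-multiple (inj₂ y≈xω0) = 1 , trans y≈xω0 (*-congˡ (sym (*-identityʳ _)))

-- The orbit S_y: q = 1 + r, Q = q^n, and Q + 1 = (q + 1)·d with d = 2E + 1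
-- odd; ω0 has order (Q + 1)(q − 1) in the finite field F, so ω = ω0^r has
-- order Q + 1 and ω^d, like every power of ω0^d, lies in F_{q^2}.
module Orbit {c′ ℓ} (F : CommutativeRing c′ ℓ) (r n E N : ℕ) (0<r : 0 < r)
    (fin : FF.IsFiniteFieldOfOrder F N)
    (Q+1≡[q+1]d : suc (suc r ℕ.^ n) ≡ suc (suc r) ℕ.* suc (E ℕ.+ E))
    (ω0 : CommutativeRing.Carrier F) (ω0-order : FF.HasOrder F ω0 ((suc r ℕ.^ n ℕ.+ 1) ℕ.* r)) where
  open CommutativeRing F
  open FF F using (pow)
  open FieldTheory F
  open FiniteField N fin
  open FF.IsFiniteFieldOfOrder fin using (nontrivial; inverses)
  open FF.Setup F (suc r) n using (InSub)
  open import Relation.Binary.Reasoning.Setoid setoid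

  q Q d : ℕ
  q = suc r
  Q = q ℕ.^ n
  d = suc (E ℕ.+ E)

  ω : Carrier
  ω = pow ω0 r

  order : ℕ
  order = (Q ℕ.+ 1) ℕ.* r

  Q+1≡ : Q ℕ.+ 1 ≡ suc q ℕ.* d
  Q+1≡ = ≡.trans (ℕP.+-comm Q 1) Q+1≡[q+1]d

  ω0-root : ∀ {m} → order ∣ m → pow ω0 m ≈ 1#
  ω0-root (divides k ≡.refl) = begin
    pow ω0 (k ℕ.* order)       ≡⟨ ≡.cong (pow ω0) (ℕP.*-comm k order) ⟩
    pow ω0 (order ℕ.* k)       ≈⟨ pow-* ω0 order k ⟩
    pow (pow ω0 order) k       ≈⟨ pow-cong k (proj₁ ω0-order) ⟩
    pow 1# k                   ≈⟨ pow-1 k ⟩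
    1#                         ∎

  0<order : 0 < order
  0<order = Arithmetic.positive (Q ℕ.+ 1) r (ℕP.m≤n+m 1 Q) 0<r

  ω0≉0 : ¬ (ω0 ≈ 0#)
  ω0≉0 ω0≈0 = nontrivial (begin
    1#                 ≈⟨ proj₁ ω0-order ⟨
    pow ω0 order       ≈⟨ pow-cong order ω0≈0 ⟩
    pow 0# order       ≈⟨ pow-0 order 0<order ⟩
    0#                 ∎)

  ω≉0 : ¬ (ω ≈ 0#)
  ω≉0 = pow-nonzero r ω0≉0

  Fq²-if-root : ∀ z → pow z (r ℕ.* suc q) ≈ 1# → InSub 2 z
  Fq²-if-root z z^[q²-1]≈1 = begin
    pow z (q ℕ.^ 2)                ≡⟨ ≡.cong (pow z) (Arithmetic.q²≡1+r[q+1] r) ⟩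
    z * pow z (r ℕ.* suc q)        ≈⟨ *-congˡ z^[q²-1]≈1 ⟩
    z * 1#                         ≈⟨ *-identityʳ z ⟩
    z                              ∎

  -- the powers ω0^(d·m) lie in F_{q^2}, since order = (q + 1)·d·(q − 1)
  ω0^d-∈Fq² : ∀ m → InSub 2 (pow ω0 (d ℕ.* m))
  ω0^d-∈Fq² m = Fq²-if-root _ (begin
    pow (pow ω0 (d ℕ.* m)) (r ℕ.* suc q)    ≈⟨ pow-* ω0 (d ℕ.* m) (r ℕ.* suc q) ⟨
    pow ω0 (d ℕ.* m ℕ.* (r ℕ.* suc q))      ≈⟨ ω0-root (divides m multiple) ⟩
    1#                                      ∎)
    where
    regroup : ∀ d m r q → d ℕ.* m ℕ.* (r ℕ.* q) ≡ m ℕ.* ((q ℕ.* d) ℕ.* r)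
    regroup = solve-∀
    multiple : d ℕ.* m ℕ.* (r ℕ.* suc q) ≡ m ℕ.* order
    multiple = ≡.trans (regroup d m r (suc q)) (≡.cong (λ u → m ℕ.* (u ℕ.* r)) (≡.sym Q+1≡))

  Fq²-resp : ∀ {a b} → a ≈ b → InSub 2 a → InSub 2 b
  Fq²-resp {a} {b} a≈b a∈Fq² = trans (pow-cong (q ℕ.^ 2) (sym a≈b)) (trans a∈Fq² a≈b)

  ωᵈ∈Fq² : InSub 2 (pow ω d)
  ωᵈ∈Fq² = Fq²-resp (trans (reflexive (≡.cong (pow ω0) (ℕP.*-comm d r))) (pow-* ω0 r d)) (ω0^d-∈Fq² r)

  Fq²-quotient : ∀ {ν μ} → InSub 2 ν → ¬ (ν ≈ 0#) → InSub 2 μ → ¬ (μ ≈ 0#) →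
    Σ Carrier λ κ → InSub 2 κ × ¬ (κ ≈ 0#) × (ν * κ ≈ μ)
  Fq²-quotient {ν} {μ} ν∈Fq² ν≉0 μ∈Fq² μ≉0 with inverses ν ν≉0
  ... | ν⁻¹ , νν⁻¹≈1 = ν⁻¹ * μ , κ∈Fq² , *-nonzero ν⁻¹≉0 μ≉0 , νκ≈μ
    where
    ν⁻¹≉0 : ¬ (ν⁻¹ ≈ 0#)
    ν⁻¹≉0 ν⁻¹≈0 = nontrivial (trans (sym νν⁻¹≈1) (trans (*-congˡ ν⁻¹≈0) (zeroʳ ν)))
    νκ≈μ : ν * (ν⁻¹ * μ) ≈ μ
    νκ≈μ = trans (sym (*-assoc _ _ _)) (trans (*-congʳ νν⁻¹≈1) (*-identityˡ μ))
    ν⁻¹∈Fq² : InSub 2 ν⁻¹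
    ν⁻¹∈Fq² = *-cancelˡ ν≉0 (begin
      ν * pow ν⁻¹ (q ℕ.^ 2)                        ≈⟨ *-congʳ ν∈Fq² ⟨
      pow ν (q ℕ.^ 2) * pow ν⁻¹ (q ℕ.^ 2)          ≈⟨ pow-distrib ν ν⁻¹ (q ℕ.^ 2) ⟨
      pow (ν * ν⁻¹) (q ℕ.^ 2)                      ≈⟨ trans (pow-cong (q ℕ.^ 2) νν⁻¹≈1) (pow-1 (q ℕ.^ 2)) ⟩
      1#                                           ≈⟨ νν⁻¹≈1 ⟨
      ν * ν⁻¹                                      ∎)
    κ∈Fq² : InSub 2 (ν⁻¹ * μ)
    κ∈Fq² = trans (pow-distrib ν⁻¹ μ (q ℕ.^ 2)) (*-cong ν⁻¹∈Fq² μ∈Fq²)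

  -- ω has order Q + 1 exactly, so the points ω^i·y (i ≤ Q) are distinct
  orbit-no-return : ∀ {y} → ¬ (y ≈ 0#) → ∀ {i j} → i < j → j < suc Q → ¬ (pow ω i * y ≈ pow ω j * y)
  orbit-no-return {y} y≉0 {i} {j} i<j j≤Q ωⁱy≈ωʲy = proj₂ ω0-order (r ℕ.* k) 0<rk rk<order ω0ʳᵏ≈1
    where
    k : ℕ
    k = j ℕ.∸ i
    i+k≡j : i ℕ.+ k ≡ j
    i+k≡j = ℕP.m+[n∸m]≡n (ℕP.<⇒≤ i<j)
    ωⁱy≉0 : ¬ (pow ω i * y ≈ 0#)
    ωⁱy≉0 = *-nonzero (pow-nonzero i ω≉0) y≉0
    ωᵏ≈1 : pow ω k ≈ 1#
    ωᵏ≈1 = sym (*-cancelˡ ωⁱy≉0 (begin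
      (pow ω i * y) * 1#               ≈⟨ *-identityʳ _ ⟩
      pow ω i * y                      ≈⟨ ωⁱy≈ωʲy ⟩
      pow ω j * y                      ≡⟨ ≡.cong (λ u → pow ω u * y) (≡.sym i+k≡j) ⟩
      pow ω (i ℕ.+ k) * y              ≈⟨ *-congʳ (pow-+ ω i k) ⟩
      pow ω i * pow ω k * y            ≈⟨ *-assoc _ _ _ ⟩
      pow ω i * (pow ω k * y)          ≈⟨ *-congˡ (*-comm _ _) ⟩
      pow ω i * (y * pow ω k)          ≈⟨ *-assoc _ _ _ ⟨
      (pow ω i * y) * pow ω k          ∎))
    ω0ʳᵏ≈1 : pow ω0 (r ℕ.* k) ≈ 1#
    ω0ʳᵏ≈1 = trans (pow-* ω0 r k) ωᵏ≈1
    0<rk : 0 < r ℕ.* k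
    0<rk = Arithmetic.positive r k 0<r (ℕP.m<n⇒0<n∸m i<j)
    rk<order : r ℕ.* k < order
    rk<order = ≡.subst (r ℕ.* k <_) (ℕP.*-comm r (Q ℕ.+ 1))
      (ℕP.*-monoʳ-< r {{ℕ.>-nonZero 0<r}} (ℕP.≤-<-trans (ℕP.m∸n≤m j i) (≡.subst (j <_) (ℕP.+-comm 1 Q) j≤Q)))

  orbit-injective : ∀ {y} → ¬ (y ≈ 0#) → ∀ {i j} → i < suc Q → j < suc Q → pow ω i * y ≈ pow ω j * y → i ≡ j
  orbit-injective y≉0 {i} {j} i≤Q j≤Q ωⁱy≈ωʲy with ℕP.<-cmp i j
  ... | tri< i<j _ _ = ⊥-elim (orbit-no-return y≉0 i<j j≤Q ωⁱy≈ωʲy)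
  ... | tri≈ _ i≡j _ = i≡j
  ... | tri> _ _ j<i = ⊥-elim (orbit-no-return y≉0 j<i i≤Q (sym ωⁱy≈ωʲy))

  module ZeroSet (additive : ∀ a b → pow (a + b) Q ≈ pow a Q + pow b Q)
      (t : Carrier) (t∈Fqⁿ : pow t Q ≈ t)
      (x : Carrier) (x∈Fqⁿ : pow x Q ≈ x) (x≉0 : ¬ (x ≈ 0#))
      (e : ℕ) (y : Carrier) (y≈xω0ᵉ : y ≈ x * pow ω0 e) where
    open Traces q n
    open FF.Setup F q n using (TrQ2)

    y≉0 : ¬ (y ≈ 0#)
    y≉0 y≈0 = *-nonzero x≉0 (pow-nonzero e ω0≉0) (trans (sym y≈xω0ᵉ) y≈0)

    T : ℕ → Carrier
    T i = TrQ2 (pow ω i * y * t)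

    Zero : ℕ → Set ℓ
    Zero i = T i ≈ 0#

    -- ω^d = ω0^(d·r) is a nonzero scalar from F_{q^2}, and T (d + i) = ω^d · T i
    T-shift : ∀ i → T (d ℕ.+ i) ≈ pow ω d * T i
    T-shift i = begin
      TrQ2 (pow ω (d ℕ.+ i) * y * t)
        ≈⟨ TrQ2-cong (trans (*-congʳ (trans (*-congʳ (pow-+ ω d i)) (*-assoc _ _ _))) (*-assoc _ _ _)) ⟩
      TrQ2 (pow ω d * (pow ω i * y * t))    ≈⟨ TrQ2-scale (pow ω d) _ ωᵈ∈Fq² ⟩
      pow ω d * T i                         ∎

    Zero-up : ∀ i → Zero i → Zero (d ℕ.+ i)
    Zero-up i Tᵢ≈0 = trans (T-shift i) (trans (*-congˡ Tᵢ≈0) (zeroʳ _))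

    Zero-down : ∀ i → Zero (d ℕ.+ i) → Zero i
    Zero-down i T[d+i]≈0 = no-zero-divisors (trans (sym (T-shift i)) T[d+i]≈0) (pow-nonzero d ω≉0)

    add-none : ∀ i d → i ℕ.+ d ℕ.* 0 ≡ i
    add-none = solve-∀

    add-one-more : ∀ i d k → i ℕ.+ d ℕ.* suc k ≡ d ℕ.+ (i ℕ.+ d ℕ.* k)
    add-one-more = solve-∀

    Zero-up* : ∀ k i → Zero i → Zero (i ℕ.+ d ℕ.* k)
    Zero-up* zero    i z = ≡.subst Zero (≡.sym (add-none i d)) z
    Zero-up* (suc k) i z = ≡.subst Zero (≡.sym (add-one-more i d k)) (Zero-up _ (Zero-up* k i z))

    Zero-down* : ∀ k i → Zero (i ℕ.+ d ℕ.* k) → Zero i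
    Zero-down* zero    i z = ≡.subst Zero (add-none i d) z
    Zero-down* (suc k) i z = Zero-down* k i (Zero-down _ (≡.subst Zero (add-one-more i d k) z))

    Zero-mod : ∀ {X Y} a b → X ℕ.+ d ℕ.* a ≡ Y ℕ.+ d ℕ.* b → Zero X → Zero Y
    Zero-mod {X} {Y} a b X≡Y z = Zero-down* b Y (≡.subst Zero X≡Y (Zero-up* a X z))

    -- Q = 1 + r·s, so the Frobenius map sends y = x·ω0^e to ω^c·y with c = e·s
    s : ℕ
    s = proj₁ (Arithmetic.power≡1-mod r n)

    Q≡1+rs : Q ≡ suc (r ℕ.* s)
    Q≡1+rs = proj₂ (Arithmetic.power≡1-mod r n)

    c : ℕ
    c = e ℕ.* s

    y-frobenius : pow y Q ≈ pow ω c * y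
    y-frobenius = begin
      pow y Q                              ≈⟨ pow-cong Q y≈xω0ᵉ ⟩
      pow (x * pow ω0 e) Q                 ≈⟨ pow-distrib x _ Q ⟩
      pow x Q * pow (pow ω0 e) Q           ≈⟨ *-cong x∈Fqⁿ (sym (pow-* ω0 e Q)) ⟩
      x * pow ω0 (e ℕ.* Q)                 ≡⟨ ≡.cong (λ u → x * pow ω0 u) exponent ⟩
      x * pow ω0 (e ℕ.+ r ℕ.* c)           ≈⟨ *-congˡ (trans (pow-+ ω0 e (r ℕ.* c)) (*-congˡ (pow-* ω0 r c))) ⟩
      x * (pow ω0 e * pow ω c)             ≈⟨ *-assoc _ _ _ ⟨
      (x * pow ω0 e) * pow ω c             ≈⟨ *-congʳ (sym y≈xω0ᵉ) ⟩
      y * pow ω c                          ≈⟨ *-comm _ _ ⟩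
      pow ω c * y                          ∎
      where
      distribute : ∀ e r s → e ℕ.* suc (r ℕ.* s) ≡ e ℕ.+ r ℕ.* (e ℕ.* s)
      distribute = solve-∀
      exponent : e ℕ.* Q ≡ e ℕ.+ r ℕ.* c
      exponent = ≡.trans (≡.cong (e ℕ.*_) Q≡1+rs) (distribute e r s)

    Zero-frobenius : ∀ i → Zero i → Zero (i ℕ.* Q ℕ.+ c)
    Zero-frobenius i Tᵢ≈0 = trans (TrQ2-cong (sym conjugate)) (TrQ2-kernel-frobenius (s≤s z≤n) additive _ Tᵢ≈0)
      where
      conjugate : pow (pow ω i * y * t) Q ≈ pow ω (i ℕ.* Q ℕ.+ c) * y * t
      conjugate = begin
        pow (pow ω i * y * t) Q                ≈⟨ pow-distrib _ t Q ⟩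
        pow (pow ω i * y) Q * pow t Q          ≈⟨ *-cong (pow-distrib _ y Q) t∈Fqⁿ ⟩
        (pow (pow ω i) Q * pow y Q) * t        ≈⟨ *-congʳ (*-cong (sym (pow-* ω i Q)) y-frobenius) ⟩
        (pow ω (i ℕ.* Q) * (pow ω c * y)) * t  ≈⟨ *-congʳ (*-assoc _ _ _) ⟨
        (pow ω (i ℕ.* Q) * pow ω c * y) * t    ≈⟨ *-congʳ (*-congʳ (pow-+ ω (i ℕ.* Q) c)) ⟨
        pow ω (i ℕ.* Q ℕ.+ c) * y * t          ∎

    -- The two symmetries combine to the reflection R + j ↦ R + (d − j) about R = c·(E + 1).
    R : ℕ
    R = c ℕ.* suc E

    Zero-reflect : ∀ j j′ → j ℕ.+ j′ ≡ d → Zero (R ℕ.+ j) → Zero (R ℕ.+ j′)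
    Zero-reflect j j′ j+j′≡d z =
      Zero-mod {(R ℕ.+ j) ℕ.* Q ℕ.+ c} {R ℕ.+ j′} (c ℕ.+ 1) ((R ℕ.+ j) ℕ.* suc q)
        (Arithmetic.reflection-index c E j j′ Q q j+j′≡d Q+1≡) (Zero-frobenius (R ℕ.+ j) z)

    -- At the centre, ω^R·y = β·x for β = ω0^(d·(e·e′)), a nonzero element of F_{q^2}.
    d∣1+rs[E+1] : Σ ℕ λ e′ → suc (r ℕ.* (s ℕ.* suc E)) ≡ d ℕ.* e′
    d∣1+rs[E+1] = Arithmetic.centre-divisible r s E Q (≡.trans (ℕP.+-comm (r ℕ.* s) 1) (≡.sym Q≡1+rs)) Q+1≡[q+1]d

    e′ : ℕ
    e′ = proj₁ d∣1+rs[E+1]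

    β : Carrier
    β = pow ω0 (d ℕ.* (e ℕ.* e′))

    centre-point : pow ω R * y ≈ β * x
    centre-point = begin
      pow ω R * y                          ≈⟨ *-cong (sym (pow-* ω0 r R)) y≈xω0ᵉ ⟩
      pow ω0 (r ℕ.* R) * (x * pow ω0 e)    ≈⟨ *-congˡ (*-comm x _) ⟩
      pow ω0 (r ℕ.* R) * (pow ω0 e * x)    ≈⟨ *-assoc _ _ _ ⟨
      pow ω0 (r ℕ.* R) * pow ω0 e * x      ≈⟨ *-congʳ (pow-+ ω0 (r ℕ.* R) e) ⟨
      pow ω0 (r ℕ.* R ℕ.+ e) * x           ≡⟨ ≡.cong (λ u → pow ω0 u * x) exponent ⟩
      β * x                                ∎
      where
      factor : ∀ r e s E → r ℕ.* (e ℕ.* s ℕ.* suc E) ℕ.+ e ≡ e ℕ.* suc (r ℕ.* (s ℕ.* suc E))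
      factor = solve-∀
      reassociate : ∀ e d e′ → e ℕ.* (d ℕ.* e′) ≡ d ℕ.* (e ℕ.* e′)
      reassociate = solve-∀
      exponent : r ℕ.* R ℕ.+ e ≡ d ℕ.* (e ℕ.* e′)
      exponent = ≡.trans (factor r e s E)
        (≡.trans (≡.cong (e ℕ.*_) (proj₂ d∣1+rs[E+1])) (reassociate e d e′))

    Zero-centre : Zero R → TrQ2 (x * t) ≈ 0#
    Zero-centre T_R≈0 = no-zero-divisors (trans βTr≈T_R T_R≈0) (pow-nonzero (d ℕ.* (e ℕ.* e′)) ω0≉0)
      where
      βTr≈T_R : β * TrQ2 (x * t) ≈ T R
      βTr≈T_R = sym (trans (TrQ2-cong (trans (*-congʳ centre-point) (*-assoc _ _ _)))
                           (TrQ2-scale β (x * t) (ω0^d-∈Fq² (e ℕ.* e′))))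

    zero? : ℕ → Bool
    zero? i = does (T i ≟ 0#)

    zero?-sound : ∀ i → zero? i ≡ true → Zero i
    zero?-sound i accepted with T i ≟ 0#
    ... | yes Tᵢ≈0 = Tᵢ≈0
    zero?-sound i () | no _

    zero?-complete : ∀ i → Zero i → zero? i ≡ true
    zero?-complete i = dec-true (T i ≟ 0#)

    zero?-cong : ∀ i j → (Zero i → Zero j) → (Zero j → Zero i) → zero? i ≡ zero? j
    zero?-cong i j i⇒j j⇒i = does-⇔ (mk⇔ i⇒j j⇒i) (T i ≟ 0#) (T j ≟ 0#)

    zero?-periodic : Counting.Periodic d zero?
    zero?-periodic i = zero?-cong (d ℕ.+ i) i (Zero-down i) (Zero-up i)

    count-orbit : Counting.count zero? (suc Q) ≡ Counting.count zero? d ℕ.* (q ℕ.+ 1)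
    count-orbit = ≡.trans (≡.cong (count zero?) Q+1≡[q+1]d)
      (≡.trans (Counting.count-periodic zero? d zero?-periodic (suc q))
        (≡.trans (ℕP.*-comm (suc q) (count zero? d)) (≡.cong (count zero? d ℕ.*_) (ℕP.+-comm 1 q))))
      where open Counting using (count)

    odd⇒Zero-centre : Counting.count zero? d ℕ.% 2 ≡ 1 → Zero R
    odd⇒Zero-centre k-odd = ≡.subst Zero (ℕP.+-identityʳ R) (zero?-sound (R ℕ.+ 0)
      (Counting.count-odd⇒centre shifted E symmetric (≡.subst (λ k → k ℕ.% 2 ≡ 1) (≡.sym window) k-odd)))
      where
      shifted : ℕ → Bool
      shifted j = zero? (R ℕ.+ j)
      symmetric : ∀ i j → i ℕ.+ j ≡ d → shifted i ≡ shifted j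
      symmetric i j i+j≡d = zero?-cong (R ℕ.+ i) (R ℕ.+ j)
        (Zero-reflect i j i+j≡d) (Zero-reflect j i (≡.trans (ℕP.+-comm j i) i+j≡d))
      window : Counting.count shifted d ≡ Counting.count zero? d
      window = Counting.count-window zero? (E ℕ.+ E) zero?-periodic R

    open FF.Setup F q n using (Vec; IsPoint; InPerp; InS; SamePoint; EnumeratesU)
    open import Algebra.Properties.Group +-group using (x∙y⁻¹≈ε⇒x≈y; x≈y⇒x∙y⁻¹≈ε)

    InU : Vec → Set (c′ ⊔ ℓ)
    InU v = IsPoint v × InPerp (0# , t) v × InS ω0 y v

    -- since t^Q = t, ⟨(a, z)⟩ ∈ R_t^⊥ exactly when TrQ2(z·t) = 0
    a·0≈0 : ∀ a → a * pow 0# q ≈ 0#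
    a·0≈0 a = trans (*-congˡ (zeroˡ _)) (zeroʳ a)

    perp⇒ : ∀ a z → InPerp (0# , t) (a , z) → TrQ2 (z * t) ≈ 0#
    perp⇒ a z perp = trans (TrQ2-cong (*-congˡ (sym t∈Fqⁿ))) (sym (trans (sym (a·0≈0 a)) (x∙y⁻¹≈ε⇒x≈y _ _ perp)))

    ⇒perp : ∀ a z → TrQ2 (z * t) ≈ 0# → InPerp (0# , t) (a , z)
    ⇒perp a z Tr≈0 = x≈y⇒x∙y⁻¹≈ε (trans (a·0≈0 a) (sym (trans (TrQ2-cong (*-congˡ t∈Fqⁿ)) Tr≈0)))

    index : ∀ {v} → InU v → ℕ
    index (_ , _ , i , _) = i

    index≤Q : ∀ {v} (u : InU v) → index u < suc Q
    index≤Q (_ , _ , _ , i≤Q , _) = i≤Q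

    index-zero : ∀ {v} (u : InU v) → Zero (index u)
    index-zero {a , z} (_ , perp , i , _ , μ , μ∈Fq² , _ , _ , ωⁱy≈μz) = begin
      TrQ2 (pow ω i * y * t)      ≈⟨ TrQ2-cong (trans (*-congʳ ωⁱy≈μz) (*-assoc _ _ _)) ⟩
      TrQ2 (μ * (z * t))          ≈⟨ TrQ2-scale μ (z * t) μ∈Fq² ⟩
      μ * TrQ2 (z * t)            ≈⟨ *-congˡ (perp⇒ a z perp) ⟩
      μ * 0#                      ≈⟨ zeroʳ μ ⟩
      0#                          ∎

    index-same : ∀ {v w} (u : InU v) (u′ : InU w) → index u ≡ index u′ → SamePoint v w
    index-same {a , z} {b , z′} (_ , _ , i , _ , μ , μ∈Fq² , μ≉0 , 1≈μa , ωⁱy≈μz)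
                                (_ , _ , j , _ , ν , ν∈Fq² , ν≉0 , 1≈νb , ωʲy≈νz′) ≡.refl
      with Fq²-quotient ν∈Fq² ν≉0 μ∈Fq² μ≉0
    ... | κ , κ∈Fq² , κ≉0 , νκ≈μ =
      κ , κ∈Fq² , κ≉0 , rescale (trans (sym 1≈νb) 1≈μa) , rescale (trans (sym ωʲy≈νz′) ωⁱy≈μz)
      where
      rescale : ∀ {w w′} → ν * w′ ≈ μ * w → w′ ≈ κ * w
      rescale νw′≈μw = *-cancelˡ ν≉0 (trans νw′≈μw (trans (*-congʳ (sym νκ≈μ)) (*-assoc _ _ _)))

    orbit-point : ∀ i → i < suc Q → Zero i → InU (1# , pow ω i * y)
    orbit-point i i≤Q Tᵢ≈0 =
      (pow-1 (q ℕ.^ 2) , λ (1≈0 , _) → nontrivial 1≈0) ,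
      ⇒perp 1# (pow ω i * y) Tᵢ≈0 ,
      (i , i≤Q , 1# , pow-1 (q ℕ.^ 2) , nontrivial , sym (*-identityˡ 1#) , sym (*-identityˡ _))

    orbit-point-index : ∀ i {w} → i < suc Q → SamePoint (1# , pow ω i * y) w → (u : InU w) → i ≡ index u
    orbit-point-index i {b , z} i≤Q (μ , _ , _ , b≈μ1 , z≈μωⁱy) (_ , _ , j , j≤Q , ν , _ , _ , 1≈νb , ωʲy≈νz) =
      orbit-injective y≉0 i≤Q j≤Q (sym (begin
        pow ω j * y              ≈⟨ ωʲy≈νz ⟩
        ν * z                    ≈⟨ *-congˡ z≈μωⁱy ⟩
        ν * (μ * (pow ω i * y))  ≈⟨ *-assoc _ _ _ ⟨
        (ν * μ) * (pow ω i * y)  ≈⟨ *-congʳ νμ≈1 ⟩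
        1# * (pow ω i * y)       ≈⟨ *-identityˡ _ ⟩
        pow ω i * y              ∎))
      where
      νμ≈1 : ν * μ ≈ 1#
      νμ≈1 = sym (trans 1≈νb (*-congˡ (trans b≈μ1 (*-identityʳ μ))))

    indices : ∀ {L} → All InU L → List ℕ
    indices []       = []
    indices (u ∷ us) = index u ∷ indices us

    indices-length : ∀ {L} (us : All InU L) → length (indices us) ≡ length L
    indices-length []       = ≡.refl
    indices-length (_ ∷ us) = ≡.cong suc (indices-length us)

    open MemberSum (≡.setoid ℕ) ℕP.+-0-commutativeMonoid (λ _ → 1) (λ _ → ≡.refl) using (_∈_; Distinct)

    indices-sound : ∀ {L} (us : All InU L) {i} → i ∈ indices us → i < suc Q × zero? i ≡ true
    indices-sound (u ∷ _)  (here ≡.refl) = index≤Q u , zero?-complete (index u) (index-zero u)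
    indices-sound (_ ∷ us) (there p)     = indices-sound us p

    indices-distinct : ∀ {L} (us : All InU L) → AllPairs (λ v w → ¬ SamePoint v w) L → Distinct (indices us)
    indices-distinct []       []         = []
    indices-distinct (u ∷ us) (new ∷ ds) = fresh us new ∷ indices-distinct us ds
      where
      fresh : ∀ {L} (us : All InU L) → All (λ w → ¬ SamePoint _ w) L → All (λ j → ¬ (index u ≡ j)) (indices us)
      fresh []        []           = []
      fresh (u′ ∷ us) (apart ∷ as) = (λ same → apart (index-same u u′ same)) ∷ fresh us as

    indices-complete : ∀ {L} (us : All InU L) →
      (∀ v → IsPoint v → InPerp (0# , t) v → InS ω0 y v → Any (SamePoint v) L) →
      ∀ i → i < suc Q → zero? i ≡ true → i ∈ indices us
    indices-complete us covers i i≤Q accepted =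
      let (point , perp , inS) = orbit-point i i≤Q (zero?-sound i accepted) in locate us (covers _ point perp inS)
      where
      locate : ∀ {L} (us : All InU L) → Any (SamePoint (1# , pow ω i * y)) L → i ∈ indices us
      locate (u ∷ _)  (here same) = here (orbit-point-index i i≤Q same u)
      locate (_ ∷ us) (there p)   = there (locate us p)

    length-U : ∀ U → EnumeratesU ω0 t y U → length U ≡ Counting.count zero? (suc Q)
    length-U U (us , distinct , covers) = ≡.trans (≡.sym (indices-length us))
      (Counting.length-by-count zero? (suc Q) (indices us)
        (indices-distinct us distinct) (indices-sound us) (indices-complete us covers))

    size-and-trace : n ℕ.% 2 ≡ 1 → ∀ U → EnumeratesU ω0 t y U →
      Σ ℕ λ k → (length U ≡ k ℕ.* (q ℕ.+ 1)) × (k ℕ.% 2 ≡ 1 → FF.Setup.TrQ F q n (x * t) ≈ 0#)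
    size-and-trace n-odd U enumeration =
      Counting.count zero? d ,
      ≡.trans (length-U U enumeration) count-orbit ,
      λ k-odd → trans (sym (TrQ2≈TrQ (n / 2) (Arithmetic.odd⇒2h+1 n n-odd) (x * t) xt∈Fqⁿ)) (Zero-centre (odd⇒Zero-centre k-odd))
      where
      xt∈Fqⁿ : pow (x * t) Q ≈ x * t
      xt∈Fqⁿ = trans (pow-distrib x t Q) (*-cong x∈Fqⁿ t∈Fqⁿ)

open import Defs
open import Level using (Level)
open import Data.Nat using (ℕ; _^_; _≤_; _%_)
open import Data.Product using (Σ; _×_; _,_)
open import Data.Sum using (_⊎_)
open import Data.List using (List; length)
open import Relation.Nullary using (¬_)
open import Relation.Binary.PropositionalEquality using (_≡_)
open import Algebra.Bundles using (CommutativeRing)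

lemma3p6 : ∀ {c ℓ : Level} (q n : ℕ) → PrimePower q → 3 ≤ n → n % 2 ≡ 1 →
    (F : CommutativeRing c ℓ) →
    let open FF F in
    let open Setup q n in
    IsFiniteFieldOfOrder (q ^ (2 Data.Nat.* n)) →
    (ω0 : Carrier) → HasOrder ω0 ((q ^ n Data.Nat.+ 1) Data.Nat.* (q Data.Nat.∸ 1)) →
    (t : Carrier) → InSub n t → ¬ (t ≈ 0#) → TrQ (t * t) ≈ 0# →
    (x : Carrier) → InSub n x → ¬ (x ≈ 0#) →
    (y : Carrier) → (y ≈ x) ⊎ (y ≈ x * ω0) →
    h (1# , y) (1# , y) ≈ 0# →
    (U : List Vec) → EnumeratesU ω0 t y U →
    Σ ℕ λ k → (length U ≡ k Data.Nat.* (q Data.Nat.+ 1)) × (k % 2 ≡ 1 → TrQ (x * t) ≈ 0#)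
-- A prime power q is at least 2, so q = 1 + r with r > 0.
lemma3p6 0 _ q-prime-power with () ← Arithmetic.primePower>1 q-prime-power
lemma3p6 1 _ q-prime-power with ℕ.s≤s () ← Arithmetic.primePower>1 q-prime-power
lemma3p6 q@(ℕ.suc r@(ℕ.suc _)) n q-prime-power _ n-odd F fin ω0 ω0-order t t∈Fqⁿ _ _ x x∈Fqⁿ x≉0 y y-cases _ U enumeration =
  let (E , Q+1≡[q+1]d) = Arithmetic.odd-power+1 r n n-odd
      (e , y≈xω0ᵉ)     = FieldTheory.as-power-multiple F y-cases
      additive         = FieldTheory.FiniteField.frobenius F _ fin (2 ℕ.* n) q-prime-power ≡.refl n
      open Orbit F r n E _ (ℕ.s≤s ℕ.z≤n) fin Q+1≡[q+1]d ω0 ω0-order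
  in ZeroSet.size-and-trace additive t t∈Fqⁿ x x∈Fqⁿ x≉0 e y y≈xω0ᵉ n-odd U enumeration
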